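{- Let \(\Gamma\) be an oriented graph or a \(2\)-edge-coloured graph. Then \(\Gamma\) admits no improper homomorphism (to any reflexive oriented graph, respectively to any reflexive \(2\)-edge-coloured graph) if and only if \(\Gamma\) is complete convex.
   Context: Graphs have no parallel edges, are connected and have at least two vertices; loops are permitted unless stated otherwise. An oriented graph arises from a graph by giving each edge a direction (an anti-symmetric digraph); a \(2\)-edge-coloured graph is a pair \((G,c_G)\) with \(c_G:E_G\to\{R,B\}\). A reflexive oriented graph has a loop at every vertex; a reflexive \(2\)-edge-coloured graph has a loop of each colour at every vertex. A homomorphism of oriented graphs \(\phi:\vec G\to\vec H\) is a map \(V_G\to V_H\) with \(\phi(u)\phi(v)\in A_{\vec H}\) for every arc \(uv\in A_{\vec G}\); a homomorphism of \(2\)-edge-coloured graphs is a vertex map preserving edges and their colours. For a reflexive target, a homomorphism is trivial if the induced map on arcs (edges) sends every arc (edge) to the same loop; improper if it is not trivial and sends at least one arc (edge) to a loop; proper if it sends no arc (edge) to a loop. In an oriented graph, \(u,v,w\) is a \(2\)-dipath with centre \(v\) if \(uv,vw\) are arcs, \(u\ne v\), \(v\ne w\). In a \(2\)-edge-coloured graph, \(u,v,w\) with \(uv,vw\) edges, \(u\ne v\ne w\), is an alternating \(2\)-path with centre \(v\) if \(c(uv)\ne c(vw)\). A set \(S\) of vertices is convex if no vertex outside \(S\) is the centre of a \(2\)-dipath (resp. alternating \(2\)-path) with both ends in \(S\); \(conv(S)\) is the smallest convex set containing \(S\), and \(conv(uv)=conv(\{u,v\})\). \(\Gamma\) is complete convex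 if \(conv(uv)=V_\Gamma\) for every arc (edge) \(uv\) of \(\Gamma\). -}

module Defs where

open import Data.Nat using (ℕ; _≤_)
open import Data.Bool using (Bool; T)
open import Data.Fin using (Fin)
open import Data.Fin.Subset using (Subset; _∈_; _∉_; ⁅_⁆; _∪_; _⊆_)
open import Data.Product using (Σ; ∃; ∃-syntax; _×_; _,_)
open import Data.Sum using (_⊎_)
open import Relation.Nullary using (¬_)
open import Data.Empty using (⊥)
open import Relation.Binary.PropositionalEquality using (_≡_; _≢_)
open import Relation.Binary.Construct.Closure.ReflexiveTransitive using (Star)

Connected : ∀ {n} → (Fin n → Fin n → Set) → Set
Connected {n} Adj = ∀ (u v : Fin n) → Star Adj u v

record OGraph : Set where
  field
    n        : ℕ
    arc      : Fin n → Fin n → Bool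
    antisym  : ∀ u v → T (arc u v) → T (arc v u) → u ≡ v
    twoVerts : 2 ≤ n
    connected : Connected (λ u v → T (arc u v) ⊎ T (arc v u))

open OGraph public

ReflexiveO : OGraph → Set
ReflexiveO H = ∀ v → T (arc H v v)

IsHomO : (G H : OGraph) → (Fin (n G) → Fin (n H)) → Set
IsHomO G H φ = ∀ u v → T (arc G u v) → T (arc H (φ u) (φ v))

TrivialO : (G H : OGraph) → (Fin (n G) → Fin (n H)) → Set
TrivialO G H φ = ∃[ w ] (∀ u v → T (arc G u v) → (φ u ≡ w × φ v ≡ w))

SendsToLoopO : (G H : OGraph) → (Fin (n G) → Fin (n H)) → Set
SendsToLoopO G H φ = ∃[ u ] ∃[ v ] (T (arc G u v) × φ u ≡ φ v)

ImproperO : (G H : OGraph) → (Fin (n G) → Fin (n H)) → Set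
ImproperO G H φ = ¬ TrivialO G H φ × SendsToLoopO G H φ

NoImproperHomO : OGraph → Set
NoImproperHomO G = ∀ (H : OGraph) → ReflexiveO H →
  ∀ (φ : Fin (n G) → Fin (n H)) → IsHomO G H φ → ¬ ImproperO G H φ

ConvexO : (G : OGraph) → Subset (n G) → Set
ConvexO G S = ∀ u v w → u ∈ S → w ∈ S → v ∉ S →
  T (arc G u v) → T (arc G v w) → u ≢ v → v ≢ w → ⊥

InConvO : (G : OGraph) → Subset (n G) → Fin (n G) → Set
InConvO G S x = ∀ (T' : Subset (n G)) → ConvexO G T' → S ⊆ T' → x ∈ T'

CompleteConvexO : OGraph → Set
CompleteConvexO G = ∀ u v → T (arc G u v) → ∀ x → InConvO G (⁅ u ⁆ ∪ ⁅ v ⁆) x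

data Colour : Set where
  R B : Colour

-- edge c u v : there is an edge uv of colour c (undirected, so symmetric).
-- No parallel edges in a graph: at most one colour on each pair {u,v}.
record CGraph : Set where
  field
    n        : ℕ
    edge     : Colour → Fin n → Fin n → Bool
    sym      : ∀ c u v → T (edge c u v) → T (edge c v u)
    noPar    : ∀ u v → T (edge R u v) → T (edge B u v) → ⊥
    twoVerts : 2 ≤ n
    connected : Connected (λ u v → ∃[ c ] T (edge c u v))

-- Reflexive 2-edge-coloured graph: a loop of each colour at every vertex
-- (the only parallel edges allowed are these two loops).
record RCGraph : Set where
  field
    n        : ℕ
    edge     : Colour → Fin n → Fin n → Bool
    sym      : ∀ c u v → T (edge c u v) → T (edge c v u)
    noPar    : ∀ u v → u ≢ v → T (edge R u v) → T (edge B u v) → ⊥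
    refl     : ∀ c v → T (edge c v v)
    twoVerts : 2 ≤ n
    connected : Connected (λ u v → ∃[ c ] T (edge c u v))

IsHomC : (G : CGraph) (H : RCGraph) → (Fin (CGraph.n G) → Fin (RCGraph.n H)) → Set
IsHomC G H φ = ∀ c u v → T (CGraph.edge G c u v) → T (RCGraph.edge H c (φ u) (φ v))

TrivialC : (G : CGraph) (H : RCGraph) → (Fin (CGraph.n G) → Fin (RCGraph.n H)) → Set
TrivialC G H φ = ∃[ w ] (∀ c u v → T (CGraph.edge G c u v) → (φ u ≡ w × φ v ≡ w))

SendsToLoopC : (G : CGraph) (H : RCGraph) → (Fin (CGraph.n G) → Fin (RCGraph.n H)) → Set
SendsToLoopC G H φ = ∃[ c ] ∃[ u ] ∃[ v ] (T (CGraph.edge G c u v) × φ u ≡ φ v)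

ImproperC : (G : CGraph) (H : RCGraph) → (Fin (CGraph.n G) → Fin (RCGraph.n H)) → Set
ImproperC G H φ = ¬ TrivialC G H φ × SendsToLoopC G H φ

NoImproperHomC : CGraph → Set
NoImproperHomC G = ∀ (H : RCGraph) →
  ∀ (φ : Fin (CGraph.n G) → Fin (RCGraph.n H)) → IsHomC G H φ → ¬ ImproperC G H φ

ConvexC : (G : CGraph) → Subset (CGraph.n G) → Set
ConvexC G S = ∀ c₁ c₂ u v w → u ∈ S → w ∈ S → v ∉ S →
  T (CGraph.edge G c₁ u v) → T (CGraph.edge G c₂ v w) → c₁ ≢ c₂ →
  u ≢ v → v ≢ w → ⊥

InConvC : (G : CGraph) → Subset (CGraph.n G) → Fin (CGraph.n G) → Set
InConvC G S x = ∀ (T' : Subset (CGraph.n G)) → ConvexC G T' → S ⊆ T' → x ∈ T'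

CompleteConvexC : CGraph → Set
CompleteConvexC G = ∀ c u v → T (CGraph.edge G c u v) → ∀ x → InConvC G (⁅ u ⁆ ∪ ⁅ v ⁆) x

module Submission where

open import Defs
open import Data.Product using (_×_; ∃-syntax; _,_; proj₁; proj₂)
open import Function.Bundles using (_⇔_; mk⇔; Equivalence)
open import Data.Bool using (T)
open import Data.Bool.Properties using (T-≡)
open import Data.Empty using (⊥; ⊥-elim)
open import Data.Fin using (Fin; _≟_)
open import Data.Fin.Properties using (any?)
open import Data.Fin.Subset using (Subset; _∈_; _∉_; ⁅_⁆; _∪_; _⊆_)
open import Data.Fin.Subset.Properties using (_∈?_; x∈⁅x⁆; x∈⁅y⁆⇒x≡y; x∈p∪q⁺; x∈p∪q⁻)
open import Data.Sum using (_⊎_; inj₁; inj₂; [_,_]; swap)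
open import Data.Vec using (tabulate)
open import Data.Vec.Properties using (lookup∘tabulate; lookup⇒[]=; []=⇒lookup)
open import Function using (flip)
open import Relation.Binary.Construct.Closure.ReflexiveTransitive
  using (Star; ε; _◅_; _◅◅_; gmap; reverse)
open import Relation.Binary.PropositionalEquality
  using (_≡_; _≢_; refl; sym; trans; subst; subst₂; ≢-sym)
open import Relation.Nullary using (¬_; Dec; yes; no; contradiction)
open import Relation.Nullary.Decidable
  using (⌊_⌋; _⊎-dec_; _×-dec_; T?; toWitness; fromWitness; decidable-stable)

-- If a homomorphism φ sends the arc (edge) uv to a loop, the fibre of φ(u) is
-- convex: a 2-dipath (alternating 2-path) leaving the fibre and returning to it
-- would be mapped onto a pair of opposite arcs (parallel edges) of the target.
-- Complete convexity then makes φ constant, i.e. trivial.  Conversely, if a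
-- convex S ⊇ {u, v} misses a vertex x, collapse S onto u and add every loop and an
-- arc (a red edge) from each vertex of S to u.  Convexity of S is exactly what
-- keeps the quotient anti-symmetric (free of parallel edges), and the collapse
-- is improper: it sends uv to the loop at u but fixes x.

∈∧∉⇒≢ : ∀ {n} {S : Subset n} {y z} → y ∈ S → z ∉ S → y ≢ z
∈∧∉⇒≢ y∈S z∉S refl = z∉S y∈S

incident : ∀ {n} {Adj : Fin n → Fin n → Set} → Connected Adj →
           ∀ {u v} → Adj u v → ∀ x → ∃[ z ] Adj x z
incident connected {u} {v} uv x with x ≟ u | connected x u
... | yes refl | _       = v , uv
... | no x≢u   | ε       = contradiction refl x≢u
... | no _     | xz ◅ _  = _ , xz

fibre : ∀ {m k} → (Fin m → Fin k) → Fin k → Subset m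
fibre f c = tabulate (λ y → ⌊ f y ≟ c ⌋)

module _ {m k} {f : Fin m → Fin k} {c : Fin k} where

  ∈-fibre⁺ : ∀ {y} → f y ≡ c → y ∈ fibre f c
  ∈-fibre⁺ {y} fy≡c = lookup⇒[]= y _
    (trans (lookup∘tabulate _ y) (Equivalence.to T-≡ (fromWitness fy≡c)))

  ∈-fibre⁻ : ∀ {y} → y ∈ fibre f c → f y ≡ c
  ∈-fibre⁻ {y} y∈ = toWitness {a? = f y ≟ c} (Equivalence.from T-≡
    (trans (sym (lookup∘tabulate _ y)) ([]=⇒lookup y∈)))

  pair⊆fibre : ∀ {u v} → f u ≡ c → f v ≡ c → ⁅ u ⁆ ∪ ⁅ v ⁆ ⊆ fibre f c
  pair⊆fibre {u} {v} fu≡c fv≡c y∈ with x∈p∪q⁻ ⁅ u ⁆ ⁅ v ⁆ y∈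
  ... | inj₁ y∈⁅u⁆ rewrite x∈⁅y⁆⇒x≡y u y∈⁅u⁆ = ∈-fibre⁺ fu≡c
  ... | inj₂ y∈⁅v⁆ rewrite x∈⁅y⁆⇒x≡y v y∈⁅v⁆ = ∈-fibre⁺ fv≡c

module Collapse {n} (S : Subset n) {u : Fin n} (u∈S : u ∈ S) where

  collapse : Fin n → Fin n
  collapse y with y ∈? S
  ... | yes _ = u
  ... | no  _ = y

  collapse-∈ : ∀ {y} → y ∈ S → collapse y ≡ u
  collapse-∈ {y} y∈S with y ∈? S
  ... | yes _   = refl
  ... | no y∉S = contradiction y∈S y∉S

  collapse⁻¹-centre : ∀ {y} → collapse y ≡ u → y ∈ S
  collapse⁻¹-centre {y} y↦u with y ∈? S
  ... | yes y∈S = y∈S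
  ... | no  _   = subst (_∈ S) (sym y↦u) u∈S

  collapse⁻¹-≢ : ∀ {y a} → collapse y ≡ a → a ≢ u → y ≡ a × a ∉ S
  collapse⁻¹-≢ {y} y↦a a≢u with y ∈? S
  ... | yes _   = contradiction (sym y↦a) a≢u
  ... | no y∉S = y↦a , subst (_∉ S) y↦a y∉S

  collapse-image-∈ : ∀ {y a} → collapse y ≡ a → a ∈ S → a ≡ u
  collapse-image-∈ {y} {a} y↦a a∈S with a ≟ u
  ... | yes a≡u = a≡u
  ... | no  a≢u = contradiction a∈S (proj₂ (collapse⁻¹-≢ {y} y↦a a≢u))

  Image : (Fin n → Fin n → Set) → Fin n → Fin n → Set
  Image E a b = ∃[ y ] ∃[ z ] (E y z × collapse y ≡ a × collapse z ≡ b)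

  image? : ∀ {E} → (∀ y z → Dec (E y z)) → ∀ a b → Dec (Image E a b)
  image? E? a b = any? λ y → any? λ z →
    E? y z ×-dec (collapse y ≟ a) ×-dec (collapse z ≟ b)

  image-flip : ∀ {E a b} → Image E b a → Image (flip E) a b
  image-flip (y , z , yz , y↦b , z↦a) = z , y , yz , z↦a , y↦b

  Spoke : Fin n → Fin n → Set
  Spoke a b = a ∈ S × b ≡ u

  spoke? : ∀ a b → Dec (Spoke a b)
  spoke? a b = (a ∈? S) ×-dec (b ≟ u)

  spoke-walk : ∀ a → Star Spoke a (collapse a)
  spoke-walk a with a ∈? S
  ... | yes a∈S = (a∈S , refl) ◅ ε
  ... | no  _   = ε

  image-spoke : ∀ {E a b} → Image E a b → Spoke a b ⊎ Spoke b a → a ≡ b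
  image-spoke (y , _ , _ , y↦a , _) (inj₁ (a∈S , b≡u)) =
    trans (collapse-image-∈ {y} y↦a a∈S) (sym b≡u)
  image-spoke (_ , z , _ , _ , z↦b) (inj₂ (b∈S , a≡u)) =
    trans a≡u (sym (collapse-image-∈ {z} z↦b b∈S))

  -- Convexity of S enters through the last two hypotheses: parallel image edges
  -- with exactly one end at u lift to a 2-path whose ends lie in S but whose
  -- centre does not.
  image-disjoint : ∀ {E₁ E₂ : Fin n → Fin n → Set} →
    (∀ {a b} → a ≢ b → E₁ a b → E₂ a b → ⊥) →
    (∀ {y z b} → y ∈ S → z ∈ S → E₁ y b → E₂ z b → b ∈ S) →
    (∀ {y z a} → y ∈ S → z ∈ S → E₁ a y → E₂ a z → a ∈ S) →
    ∀ {a b} → a ≢ b → Image E₁ a b → Image E₂ a b → ⊥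
  image-disjoint {E₁} {E₂} disjoint closed-in closed-out {a} {b} a≢b
    (y , z , e₁ , y↦a , z↦b) (y′ , z′ , e₂ , y′↦a , z′↦b) with a ≟ u | b ≟ u
  ... | yes a≡u | yes b≡u = a≢b (trans a≡u (sym b≡u))
  ... | yes a≡u | no b≢u =
    let z≡b , b∉S = collapse⁻¹-≢ {z} z↦b b≢u
        z′≡b , _   = collapse⁻¹-≢ {z′} z′↦b b≢u
    in b∉S (closed-in (collapse⁻¹-centre (trans y↦a a≡u))
                      (collapse⁻¹-centre (trans y′↦a a≡u))
                      (subst (E₁ y) z≡b e₁) (subst (E₂ y′) z′≡b e₂))
  ... | no a≢u | yes b≡u =
    let y≡a , a∉S = collapse⁻¹-≢ {y} y↦a a≢u
        y′≡a , _   = collapse⁻¹-≢ {y′} y′↦a a≢u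
    in a∉S (closed-out (collapse⁻¹-centre (trans z↦b b≡u))
                       (collapse⁻¹-centre (trans z′↦b b≡u))
                       (subst (flip E₁ z) y≡a e₁) (subst (flip E₂ z′) y′≡a e₂))
  ... | no a≢u | no b≢u =
    let y≡a = proj₁ (collapse⁻¹-≢ {y} y↦a a≢u)
        z≡b = proj₁ (collapse⁻¹-≢ {z} z↦b b≢u)
        y′≡a = proj₁ (collapse⁻¹-≢ {y′} y′↦a a≢u)
        z′≡b = proj₁ (collapse⁻¹-≢ {z′} z′↦b b≢u)
    in disjoint a≢b (subst₂ E₁ y≡a z≡b e₁) (subst₂ E₂ y′≡a z′≡b e₂)

  collapse-connected : ∀ {Adj Adj′ : Fin n → Fin n → Set} →
    (∀ {a b} → Spoke a b → Adj′ a b) → (∀ {a b} → Adj′ a b → Adj′ b a) →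
    (∀ {y z} → Adj y z → Adj′ (collapse y) (collapse z)) →
    Connected Adj → Connected Adj′
  collapse-connected spoke sym′ image connected a b =
    gmap _ spoke (spoke-walk a) ◅◅ gmap collapse image (connected a b)
      ◅◅ reverse (λ s → sym′ (spoke s)) (spoke-walk b)

module Oriented (Γ : OGraph) where

  Arc : Fin (n Γ) → Fin (n Γ) → Set
  Arc y z = T (arc Γ y z)

  convexO-closed : ∀ {S y v w} → ConvexO Γ S → y ∈ S → w ∈ S →
                   Arc y v → Arc v w → v ∈ S
  convexO-closed {S} {v = v} convex y∈S w∈S yv vw with v ∈? S
  ... | yes v∈S = v∈S
  ... | no  v∉S = ⊥-elim (convex _ v _ y∈S w∈S v∉S yv vw
                           (∈∧∉⇒≢ y∈S v∉S) (≢-sym (∈∧∉⇒≢ w∈S v∉S)))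

  trivialO⇒constant : ∀ {H φ} → TrivialO Γ H φ →
                      ∀ {u v} → Arc u v → ∀ x → φ x ≡ φ u
  trivialO⇒constant (w , toLoop) uv x with incident (connected Γ) (inj₁ uv) x
  ... | z , inj₁ xz = trans (proj₁ (toLoop _ z xz)) (sym (proj₁ (toLoop _ _ uv)))
  ... | z , inj₂ zx = trans (proj₂ (toLoop z _ zx)) (sym (proj₁ (toLoop _ _ uv)))

  fibre-convexO : ∀ {H φ} → IsHomO Γ H φ → ∀ c → ConvexO Γ (fibre φ c)
  fibre-convexO {H} {φ} hom c a y b a∈ b∈ y∉ ay yb _ _ =
    y∉ (∈-fibre⁺ (sym (antisym H c (φ y)
      (subst (λ p → T (arc H p (φ y))) (∈-fibre⁻ a∈) (hom a y ay))
      (subst (λ p → T (arc H (φ y) p)) (∈-fibre⁻ b∈) (hom y b yb)))))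

  completeConvexO⇒noImproperHomO : CompleteConvexO Γ → NoImproperHomO Γ
  completeConvexO⇒noImproperHomO complete H _ φ hom (nontrivial , u , v , uv , φu≡φv) =
    nontrivial (φ u , λ y z _ → constant y , constant z)
    where
    constant : ∀ x → φ x ≡ φ u
    constant x = ∈-fibre⁻ (complete u v uv x (fibre φ (φ u)) (fibre-convexO {H} hom (φ u))
                                     (pair⊆fibre refl (sym φu≡φv)))

  module Contraction {S} (convex : ConvexO Γ S) {u} (u∈S : u ∈ S) where
    open Collapse S u∈S public

    ArcH : Fin (n Γ) → Fin (n Γ) → Set
    ArcH a b = a ≡ b ⊎ Spoke a b ⊎ Image Arc a b

    arcH? : ∀ a b → Dec (ArcH a b)
    arcH? a b = (a ≟ b) ⊎-dec spoke? a b ⊎-dec image? (λ y z → T? (arc Γ y z)) a b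

    arcH-antisym : ∀ {a b} → ArcH a b → ArcH b a → a ≡ b
    arcH-antisym (inj₁ a≡b) _ = a≡b
    arcH-antisym _ (inj₁ b≡a) = sym b≡a
    arcH-antisym (inj₂ (inj₁ (_ , b≡u))) (inj₂ (inj₁ (_ , a≡u))) = trans a≡u (sym b≡u)
    arcH-antisym (inj₂ (inj₁ ab)) (inj₂ (inj₂ ba)) = sym (image-spoke ba (inj₂ ab))
    arcH-antisym (inj₂ (inj₂ ab)) (inj₂ (inj₁ ba)) = image-spoke ab (inj₂ ba)
    arcH-antisym {a} {b} (inj₂ (inj₂ ab)) (inj₂ (inj₂ ba)) =
      decidable-stable (a ≟ b) λ a≢b → image-disjoint
        (λ y≢z yz zy → y≢z (antisym Γ _ _ yz zy))
        (convexO-closed convex)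
        (λ y∈S z∈S ay za → convexO-closed convex z∈S y∈S za ay)
        a≢b ab (image-flip ba)

    H : OGraph
    H = record
      { n         = n Γ
      ; arc       = λ a b → ⌊ arcH? a b ⌋
      ; antisym   = λ a b ab ba → arcH-antisym (toWitness ab) (toWitness ba)
      ; twoVerts  = twoVerts Γ
      ; connected = collapse-connected (λ s → inj₁ (fromWitness (inj₂ (inj₁ s)))) swap
          [ (λ yz → inj₁ (fromWitness (inj₂ (inj₂ (_ , _ , yz , refl , refl)))))
          , (λ zy → inj₂ (fromWitness (inj₂ (inj₂ (_ , _ , zy , refl , refl))))) ]
          (connected Γ)
      }

    H-reflexive : ReflexiveO H
    H-reflexive a = fromWitness (inj₁ refl)

    collapse-homO : IsHomO Γ H collapse
    collapse-homO y z yz = fromWitness (inj₂ (inj₂ (y , z , yz , refl , refl)))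

  noImproperHomO⇒completeConvexO : NoImproperHomO Γ → CompleteConvexO Γ
  noImproperHomO⇒completeConvexO noImproper u v uv x S convex pair⊆S with x ∈? S
  ... | yes x∈S = x∈S
  ... | no  x∉S = ⊥-elim (noImproper H H-reflexive collapse collapse-homO
                    (nontrivial , u , v , uv , trans (collapse-∈ u∈S) (sym (collapse-∈ v∈S))))
    where
    u∈S : u ∈ S
    u∈S = pair⊆S (x∈p∪q⁺ (inj₁ (x∈⁅x⁆ u)))
    v∈S : v ∈ S
    v∈S = pair⊆S (x∈p∪q⁺ (inj₂ (x∈⁅x⁆ v)))
    open Contraction convex u∈S
    nontrivial : ¬ TrivialO Γ H collapse
    nontrivial trivial = x∉S (collapse⁻¹-centre
      (trans (trivialO⇒constant {H} trivial uv x) (collapse-∈ u∈S)))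

noPar-≢ : ∀ (H : RCGraph) {c₁ c₂ a b} → c₁ ≢ c₂ → a ≢ b →
          T (RCGraph.edge H c₁ a b) → T (RCGraph.edge H c₂ a b) → ⊥
noPar-≢ H {R} {R} c₁≢c₂ _ _ _ = c₁≢c₂ refl
noPar-≢ H {R} {B} _ a≢b red blue = RCGraph.noPar H _ _ a≢b red blue
noPar-≢ H {B} {R} _ a≢b blue red = RCGraph.noPar H _ _ a≢b red blue
noPar-≢ H {B} {B} c₁≢c₂ _ _ _ = c₁≢c₂ refl

module Coloured (Γ : CGraph) where

  Edge : Colour → Fin (CGraph.n Γ) → Fin (CGraph.n Γ) → Set
  Edge c y z = T (CGraph.edge Γ c y z)

  convexC-closed : ∀ {S c₁ c₂ y v w} → ConvexC Γ S → c₁ ≢ c₂ → y ∈ S → w ∈ S →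
                   Edge c₁ y v → Edge c₂ v w → v ∈ S
  convexC-closed {S} {v = v} convex c₁≢c₂ y∈S w∈S yv vw with v ∈? S
  ... | yes v∈S = v∈S
  ... | no  v∉S = ⊥-elim (convex _ _ _ v _ y∈S w∈S v∉S yv vw c₁≢c₂
                           (∈∧∉⇒≢ y∈S v∉S) (≢-sym (∈∧∉⇒≢ w∈S v∉S)))

  trivialC⇒constant : ∀ {H φ} → TrivialC Γ H φ →
                      ∀ {c u v} → Edge c u v → ∀ x → φ x ≡ φ u
  trivialC⇒constant (w , toLoop) uv x with incident (CGraph.connected Γ) (_ , uv) x
  ... | z , (_ , xz) = trans (proj₁ (toLoop _ _ z xz)) (sym (proj₁ (toLoop _ _ _ uv)))

  fibre-convexC : ∀ {H φ} → IsHomC Γ H φ → ∀ c → ConvexC Γ (fibre φ c)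
  fibre-convexC {H} {φ} hom c c₁ c₂ a y b a∈ b∈ y∉ ay yb c₁≢c₂ _ _ =
    y∉ (∈-fibre⁺ (decidable-stable (φ y ≟ c) λ φy≢c →
      noPar-≢ H c₁≢c₂ (≢-sym φy≢c)
        (subst (λ p → T (RCGraph.edge H c₁ p (φ y))) (∈-fibre⁻ a∈) (hom c₁ a y ay))
        (RCGraph.sym H c₂ _ _
          (subst (λ p → T (RCGraph.edge H c₂ (φ y) p)) (∈-fibre⁻ b∈) (hom c₂ y b yb)))))

  completeConvexC⇒noImproperHomC : CompleteConvexC Γ → NoImproperHomC Γ
  completeConvexC⇒noImproperHomC complete H φ hom (nontrivial , c , u , v , uv , φu≡φv) =
    nontrivial (φ u , λ _ y z _ → constant y , constant z)
    where
    constant : ∀ x → φ x ≡ φ u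
    constant x = ∈-fibre⁻ (complete c u v uv x (fibre φ (φ u)) (fibre-convexC {H} hom (φ u))
                                     (pair⊆fibre refl (sym φu≡φv)))

  module Contraction {S} (convex : ConvexC Γ S) {u} (u∈S : u ∈ S) where
    open Collapse S u∈S public

    Spokes : Colour → Fin (CGraph.n Γ) → Fin (CGraph.n Γ) → Set
    Spokes R a b = Spoke a b ⊎ Spoke b a
    Spokes B _ _ = ⊥

    spokes? : ∀ c a b → Dec (Spokes c a b)
    spokes? R a b = spoke? a b ⊎-dec spoke? b a
    spokes? B _ _ = no λ ()

    EdgeH : Colour → Fin (CGraph.n Γ) → Fin (CGraph.n Γ) → Set
    EdgeH c a b = a ≡ b ⊎ Spokes c a b ⊎ Image (Edge c) a b

    edgeH? : ∀ c a b → Dec (EdgeH c a b)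
    edgeH? c a b =
      (a ≟ b) ⊎-dec spokes? c a b ⊎-dec image? (λ y z → T? (CGraph.edge Γ c y z)) a b

    edgeH-sym : ∀ {c a b} → EdgeH c a b → EdgeH c b a
    edgeH-sym (inj₁ a≡b) = inj₁ (sym a≡b)
    edgeH-sym {R} (inj₂ (inj₁ s)) = inj₂ (inj₁ (swap s))
    edgeH-sym (inj₂ (inj₂ (y , z , yz , y↦a , z↦b))) =
      inj₂ (inj₂ (z , y , CGraph.sym Γ _ y z yz , z↦b , y↦a))

    edgeH-noPar : ∀ {a b} → a ≢ b → EdgeH R a b → EdgeH B a b → ⊥
    edgeH-noPar a≢b (inj₁ a≡b) _ = a≢b a≡b
    edgeH-noPar a≢b _ (inj₁ a≡b) = a≢b a≡b
    edgeH-noPar a≢b (inj₂ (inj₁ s)) (inj₂ (inj₂ blue)) = a≢b (image-spoke blue s)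
    edgeH-noPar a≢b (inj₂ (inj₂ red)) (inj₂ (inj₂ blue)) = image-disjoint
      (λ _ red′ blue′ → CGraph.noPar Γ _ _ red′ blue′)
      (λ y∈S z∈S yb zb → convexC-closed convex (λ ()) y∈S z∈S yb (CGraph.sym Γ B _ _ zb))
      (λ y∈S z∈S ay az → convexC-closed convex (λ ()) y∈S z∈S (CGraph.sym Γ R _ _ ay) az)
      a≢b red blue

    H : RCGraph
    H = record
      { n         = CGraph.n Γ
      ; edge      = λ c a b → ⌊ edgeH? c a b ⌋
      ; sym       = λ c a b ab → fromWitness (edgeH-sym (toWitness ab))
      ; noPar     = λ a b a≢b red blue → edgeH-noPar a≢b (toWitness red) (toWitness blue)
      ; refl      = λ c a → fromWitness (inj₁ refl)
      ; twoVerts  = CGraph.twoVerts Γ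
      ; connected = collapse-connected
          (λ s → R , fromWitness (inj₂ (inj₁ (inj₁ s))))
          (λ (c , ab) → c , fromWitness (edgeH-sym (toWitness ab)))
          (λ (c , yz) → c , fromWitness (inj₂ (inj₂ (_ , _ , yz , refl , refl))))
          (CGraph.connected Γ)
      }

    collapse-homC : IsHomC Γ H collapse
    collapse-homC c y z yz = fromWitness (inj₂ (inj₂ (y , z , yz , refl , refl)))

  noImproperHomC⇒completeConvexC : NoImproperHomC Γ → CompleteConvexC Γ
  noImproperHomC⇒completeConvexC noImproper c u v uv x S convex pair⊆S with x ∈? S
  ... | yes x∈S = x∈S
  ... | no  x∉S = ⊥-elim (noImproper H collapse collapse-homC
                    (nontrivial , c , u , v , uv , trans (collapse-∈ u∈S) (sym (collapse-∈ v∈S))))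
    where
    u∈S : u ∈ S
    u∈S = pair⊆S (x∈p∪q⁺ (inj₁ (x∈⁅x⁆ u)))
    v∈S : v ∈ S
    v∈S = pair⊆S (x∈p∪q⁺ (inj₂ (x∈⁅x⁆ v)))
    open Contraction convex u∈S
    nontrivial : ¬ TrivialC Γ H collapse
    nontrivial trivial = x∉S (collapse⁻¹-centre
      (trans (trivialC⇒constant {H} trivial uv x) (collapse-∈ u∈S)))

theorem2 : (∀ (Γ : OGraph) → NoImproperHomO Γ ⇔ CompleteConvexO Γ)
         × (∀ (Γ : CGraph) → NoImproperHomC Γ ⇔ CompleteConvexC Γ)
theorem2 =
  (λ Γ → mk⇔ (Oriented.noImproperHomO⇒completeConvexO Γ)
             (Oriented.completeConvexO⇒noImproperHomO Γ)) ,
  (λ Γ → mk⇔ (Coloured.noImproperHomC⇒completeConvexC Γ)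
             (Coloured.completeConvexC⇒noImproperHomC Γ))
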